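{- Let $n\ge 2$, let $0\le \alpha_1<\alpha_2<\dots<\alpha_n$ be integers, and let $x_1,\dots,x_n$ be positive integers. For $0\le k\le n$ put $p_k=\sum_{i=1}^k x_i$ and $q_k=\sum_{i=1}^k \alpha_i x_i$ (so $p_0=q_0=0$). Then $$\sum_{i=1}^k \alpha_i x_i \;\ge\; \frac{\left(\sum_{i=1}^k x_i\right)\left(\sum_{i=1}^k x_i-1\right)}{2}\quad\text{for all } 1\le k\le n,\ \text{with equality for } k=n,$$ holds if and only if for every $k$ with $1\le k\le n$, $$q_{k-1}-\frac{p_{k-1}(p_{k-1}-1)}{2}\ge 0\quad\text{and}\quad 1\le x_k\le \frac{\bigl(2(\alpha_k-p_{k-1})+1\bigr)+\sqrt{\bigl(2(\alpha_k-p_{k-1})+1\bigr)^2+8\bigl(q_{k-1}-p_{k-1}(p_{k-1}-1)/2\bigr)}}{2},$$ with equality in the right-hand inequality when $k=n$.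
   Context: Here $\{\alpha_1,\dots,\alpha_n\}$ plays the role of a score (degree) set of a tournament and $x_i$ is the number of times the score $\alpha_i$ occurs in a score sequence. -}

module Defs where

open import Data.Nat as ℕ using (ℕ; zero; suc; _∸_)
open import Data.Nat.DivMod using (_/_)
open import Data.Fin using (Fin; zero; suc)
open import Data.Integer as ℤ using (ℤ; +_; _-_; 0ℤ; 1ℤ)
open import Data.Sum using (_⊎_)
open import Data.Product using (_×_)
open import Relation.Binary.PropositionalEquality using (_≡_)

-- partialSum f k = f 0 + f 1 + ... + f (k-1)   (sum of the first k entries,
-- truncated at n).  With 1-based paper indices this is Σ_{i=1}^k.
partialSum : ∀ {n} → (Fin n → ℕ) → ℕ → ℕ
partialSum {n}     f zero    = 0
partialSum {zero}  f (suc k) = 0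
partialSum {suc n} f (suc k) = f zero ℕ.+ partialSum (λ i → f (suc i)) k

pSum : ∀ {n} → (Fin n → ℕ) → ℕ → ℕ
pSum x k = partialSum x k

qSum : ∀ {n} → (Fin n → ℕ) → (Fin n → ℕ) → ℕ → ℕ
qSum α x k = partialSum (λ i → α i ℕ.* x i) k

-- p (p - 1) / 2  (exact: p (p - 1) is always even)
tri : ℕ → ℕ
tri p = (p ℕ.* (p ∸ 1)) / 2

-- Real square roots are unavailable.  For integers x, b and D ≥ 0:
--   x ≤ (b + √D)/2   ⟺  2x - b ≤ 0  or  (2x - b)² ≤ D
--   x = (b + √D)/2   ⟺  2x - b ≥ 0  and (2x - b)² = D
LeHalfBPlusSqrt : ℤ → ℤ → ℤ → Set
LeHalfBPlusSqrt x b D =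
  ((+ 2) ℤ.* x - b ℤ.≤ 0ℤ) ⊎ (((+ 2) ℤ.* x - b) ℤ.* ((+ 2) ℤ.* x - b) ℤ.≤ D)

EqHalfBPlusSqrt : ℤ → ℤ → ℤ → Set
EqHalfBPlusSqrt x b D =
  (0ℤ ℤ.≤ (+ 2) ℤ.* x - b) × (((+ 2) ℤ.* x - b) ℤ.* ((+ 2) ℤ.* x - b) ≡ D)

-- Quantities in the k-th condition (j = k - 1 is the 0-based index of α_k, x_k):
-- b_k = 2(α_k - p_{k-1}) + 1,  c_k = q_{k-1} - p_{k-1}(p_{k-1}-1)/2,
-- D_k = b_k² + 8 c_k.
bK : ∀ {n} → (Fin n → ℕ) → (Fin n → ℕ) → Fin n → ℤ
bK α x j = (+ 2) ℤ.* (+ α j - + pSum x (Data.Fin.toℕ j)) ℤ.+ 1ℤ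

cK : ∀ {n} → (Fin n → ℕ) → (Fin n → ℕ) → Fin n → ℤ
cK α x j = + qSum α x (Data.Fin.toℕ j) - + tri (pSum x (Data.Fin.toℕ j))

DK : ∀ {n} → (Fin n → ℕ) → (Fin n → ℕ) → Fin n → ℤ
DK α x j = bK α x j ℤ.* bK α x j ℤ.+ (+ 8) ℤ.* cK α x j

{-# OPTIONS --safe #-}
module Submission where

-- Put p = p_{k-1}, q = q_{k-1}, b = b_k, c = q - p(p-1)/2 and D = b² + 8c.
-- Appending the x = x_k copies of α_k turns (p , q) into (p + x , q + α_k x),
-- and a direct computation gives
--   8 ((q + α_k x) - (p + x)(p + x - 1)/2) = D - (2x - b)².
-- So, given Landau's inequality for the first k - 1 blocks, the inequality for
-- the first k blocks says that x lies between the roots (b ± √D)/2, and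
-- equality says that x is one of them.  As c ≥ 0 and x ≥ 1, already 2x ≤ b
-- forces (2x - b)² < D: the lower root never binds and equality picks the
-- upper one.  The conditions for k = 1, …, n therefore unfold the inequalities
-- one block at a time.

open import Defs
open import Data.Nat as ℕ using (ℕ; zero; suc; _≤_; _<_; z≤n; s≤s)
import Data.Nat.Properties as ℕ
open import Data.Nat.DivMod using (_/_; m*n/n≡m)
import Data.Nat.Tactic.RingSolver as ℕ-Solver
open import Data.Fin using (Fin; zero; suc; toℕ; fromℕ; fromℕ<)
open import Data.Fin.Properties using (toℕ<n; toℕ-fromℕ; toℕ-fromℕ<)
open import Data.Integer as ℤ using (ℤ; +_; 0ℤ; 1ℤ; +≤+; +<+; positive)
import Data.Integer.Properties as ℤ
open import Data.Integer.Tactic.RingSolver using (solve; solve-∀)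
open import Data.List using (_∷_; [])
open import Data.Product using (_×_; _,_; proj₂)
open import Data.Sum using (inj₁; inj₂; [_,_]′)
open import Data.Empty using (⊥-elim)
open import Function using (id)
open import Function.Bundles using (_⇔_; mk⇔; Equivalence)
open import Function.Properties.Equivalence using () renaming (trans to ⇔-trans)
open import Relation.Binary.PropositionalEquality
  using (_≡_; refl; sym; trans; cong; cong₂; subst; subst₂; module ≡-Reasoning)
open ≡-Reasoning

open Equivalence using (to; from)

partialSum-suc : ∀ {n} (f : Fin n → ℕ) (j : Fin n) →
                 partialSum f (suc (toℕ j)) ≡ partialSum f (toℕ j) ℕ.+ f j
partialSum-suc f zero    = ℕ.+-identityʳ (f zero)
partialSum-suc f (suc j) = begin
  f zero ℕ.+ partialSum (λ i → f (suc i)) (suc (toℕ j))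
    ≡⟨ cong (f zero ℕ.+_) (partialSum-suc (λ i → f (suc i)) j) ⟩
  f zero ℕ.+ (partialSum (λ i → f (suc i)) (toℕ j) ℕ.+ f (suc j))
    ≡⟨ ℕ.+-assoc (f zero) _ _ ⟨
  f zero ℕ.+ partialSum (λ i → f (suc i)) (toℕ j) ℕ.+ f (suc j) ∎

triangular : ℕ → ℕ
triangular zero    = 0
triangular (suc p) = p ℕ.+ triangular p

triangular*2+p≡p*p : ∀ p → triangular p ℕ.* 2 ℕ.+ p ≡ p ℕ.* p
triangular*2+p≡p*p zero    = refl
triangular*2+p≡p*p (suc p) = step (triangular*2+p≡p*p p)
  where
  step : ∀ {t} → t ℕ.* 2 ℕ.+ p ≡ p ℕ.* p → (p ℕ.+ t) ℕ.* 2 ℕ.+ suc p ≡ suc p ℕ.* suc p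
  step {t} t*2+p≡p*p = begin
    (p ℕ.+ t) ℕ.* 2 ℕ.+ suc p       ≡⟨ ℕ-Solver.solve (p ∷ t ∷ []) ⟩
    suc (p ℕ.* 2 ℕ.+ (t ℕ.* 2 ℕ.+ p)) ≡⟨ cong (λ s → suc (p ℕ.* 2 ℕ.+ s)) t*2+p≡p*p ⟩
    suc (p ℕ.* 2 ℕ.+ p ℕ.* p)         ≡⟨ ℕ-Solver.solve (p ∷ []) ⟩
    suc p ℕ.* suc p                   ∎

p*[p∸1]+p≡p*p : ∀ p → p ℕ.* (p ℕ.∸ 1) ℕ.+ p ≡ p ℕ.* p
p*[p∸1]+p≡p*p zero    = refl
p*[p∸1]+p≡p*p (suc p) = trans (ℕ.+-comm (suc p ℕ.* p) (suc p)) (sym (ℕ.*-suc (suc p) p))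

tri≡triangular : ∀ p → tri p ≡ triangular p
tri≡triangular p = begin
  p ℕ.* (p ℕ.∸ 1) / 2
    ≡⟨ cong (_/ 2) (ℕ.+-cancelʳ-≡ p _ _ (trans (p*[p∸1]+p≡p*p p) (sym (triangular*2+p≡p*p p)))) ⟩
  triangular p ℕ.* 2 / 2
    ≡⟨ m*n/n≡m (triangular p) 2 ⟩
  triangular p ∎

+tri*2++p≡+p*+p : ∀ p → + tri p ℤ.* + 2 ℤ.+ + p ≡ + p ℤ.* + p
+tri*2++p≡+p*+p p = begin
  + tri p ℤ.* + 2 ℤ.+ + p    ≡⟨ cong (ℤ._+ + p) (ℤ.pos-* (tri p) 2) ⟨
  + (tri p ℕ.* 2) ℤ.+ + p    ≡⟨ ℤ.pos-+ (tri p ℕ.* 2) p ⟨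
  + (tri p ℕ.* 2 ℕ.+ p)      ≡⟨ cong (λ t → + (t ℕ.* 2 ℕ.+ p)) (tri≡triangular p) ⟩
  + (triangular p ℕ.* 2 ℕ.+ p) ≡⟨ cong +_ (triangular*2+p≡p*p p) ⟩
  + (p ℕ.* p)                ≡⟨ ℤ.pos-* p p ⟩
  + p ℤ.* + p                ∎

D-[2x-b]²≡4x[x-[2x-b]]+8c : ∀ x b c →
  b ℤ.* b ℤ.+ + 8 ℤ.* c ℤ.- (+ 2 ℤ.* x ℤ.- b) ℤ.* (+ 2 ℤ.* x ℤ.- b)
    ≡ + 4 ℤ.* (x ℤ.* (x ℤ.- (+ 2 ℤ.* x ℤ.- b))) ℤ.+ + 8 ℤ.* c
D-[2x-b]²≡4x[x-[2x-b]]+8c = solve-∀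

module _ {x b c : ℤ} (0<x : 0ℤ ℤ.< x) (0≤c : 0ℤ ℤ.≤ c) where
  private
    D = b ℤ.* b ℤ.+ + 8 ℤ.* c
    z = + 2 ℤ.* x ℤ.- b

  2x-b≤0⇒0<D-[2x-b]² : z ℤ.≤ 0ℤ → 0ℤ ℤ.< D ℤ.- z ℤ.* z
  2x-b≤0⇒0<D-[2x-b]² z≤0 =
    subst (0ℤ ℤ.<_) (sym (D-[2x-b]²≡4x[x-[2x-b]]+8c x b c))
      (ℤ.+-mono-<-≤ (ℤ.*-monoˡ-<-pos (+ 4) 0<x[x-z]) (ℤ.*-monoˡ-≤-nonNeg (+ 8) 0≤c))
    where
    0<x[x-z] : 0ℤ ℤ.< x ℤ.* (x ℤ.- z)
    0<x[x-z] = subst (ℤ._< x ℤ.* (x ℤ.- z)) (ℤ.*-zeroʳ x)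
      (ℤ.*-monoˡ-<-pos x {{positive 0<x}} (ℤ.+-mono-<-≤ 0<x (ℤ.neg-mono-≤ z≤0)))

  LeHalfBPlusSqrt⇔[2x-b]²≤D : LeHalfBPlusSqrt x b D ⇔ z ℤ.* z ℤ.≤ D
  LeHalfBPlusSqrt⇔[2x-b]²≤D = mk⇔
    [ (λ z≤0 → ℤ.0≤i-j⇒j≤i (ℤ.<⇒≤ (2x-b≤0⇒0<D-[2x-b]² z≤0))) , id ]′
    inj₂

  EqHalfBPlusSqrt⇔[2x-b]²≡D : EqHalfBPlusSqrt x b D ⇔ z ℤ.* z ≡ D
  EqHalfBPlusSqrt⇔[2x-b]²≡D = mk⇔ proj₂ [2x-b]²≡D⇒EqHalf
    where
    [2x-b]²≡D⇒EqHalf : z ℤ.* z ≡ D → EqHalfBPlusSqrt x b D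
    [2x-b]²≡D⇒EqHalf z²≡D with ℤ.≤-total z 0ℤ
    ... | inj₁ z≤0 = ⊥-elim (ℤ.<-irrefl (sym (ℤ.i≡j⇒i-j≡0 (sym z²≡D))) (2x-b≤0⇒0<D-[2x-b]² z≤0))
    ... | inj₂ 0≤z = 0≤z , z²≡D

discriminant-gap : ∀ (p q a x t t′ : ℤ) →
  t ℤ.* + 2 ℤ.+ p ≡ p ℤ.* p → t′ ℤ.* + 2 ℤ.+ (p ℤ.+ x) ≡ (p ℤ.+ x) ℤ.* (p ℤ.+ x) →
  let b = + 2 ℤ.* (a ℤ.- p) ℤ.+ 1ℤ in
  b ℤ.* b ℤ.+ + 8 ℤ.* (q ℤ.- t) ℤ.- (+ 2 ℤ.* x ℤ.- b) ℤ.* (+ 2 ℤ.* x ℤ.- b)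
    ≡ + 8 ℤ.* (q ℤ.+ a ℤ.* x ℤ.- t′)
discriminant-gap p q a x t t′ t*2+p≡p*p t′*2+p′≡p′*p′ = begin
  (+ 2 ℤ.* (a ℤ.- p) ℤ.+ 1ℤ) ℤ.* (+ 2 ℤ.* (a ℤ.- p) ℤ.+ 1ℤ) ℤ.+ + 8 ℤ.* (q ℤ.- t)
    ℤ.- (+ 2 ℤ.* x ℤ.- (+ 2 ℤ.* (a ℤ.- p) ℤ.+ 1ℤ)) ℤ.* (+ 2 ℤ.* x ℤ.- (+ 2 ℤ.* (a ℤ.- p) ℤ.+ 1ℤ))
    ≡⟨ solve (p ∷ q ∷ a ∷ x ∷ t ∷ []) ⟩
  + 8 ℤ.* (q ℤ.+ a ℤ.* x) ℤ.- + 4 ℤ.* ((p ℤ.+ x) ℤ.* (p ℤ.+ x)) ℤ.+ + 4 ℤ.* (p ℤ.* p)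
    ℤ.+ + 4 ℤ.* x ℤ.- + 8 ℤ.* t
    ≡⟨ cong₂ (λ u v → + 8 ℤ.* (q ℤ.+ a ℤ.* x) ℤ.- + 4 ℤ.* u ℤ.+ + 4 ℤ.* v ℤ.+ + 4 ℤ.* x ℤ.- + 8 ℤ.* t)
             t′*2+p′≡p′*p′ t*2+p≡p*p ⟨
  + 8 ℤ.* (q ℤ.+ a ℤ.* x) ℤ.- + 4 ℤ.* (t′ ℤ.* + 2 ℤ.+ (p ℤ.+ x)) ℤ.+ + 4 ℤ.* (t ℤ.* + 2 ℤ.+ p)
    ℤ.+ + 4 ℤ.* x ℤ.- + 8 ℤ.* t
    ≡⟨ solve (p ∷ q ∷ a ∷ x ∷ t ∷ t′ ∷ []) ⟩
  + 8 ℤ.* (q ℤ.+ a ℤ.* x ℤ.- t′) ∎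

module _ (P Q A X : ℕ) where
  private
    b = + 2 ℤ.* (+ A ℤ.- + P) ℤ.+ 1ℤ
    D = b ℤ.* b ℤ.+ + 8 ℤ.* (+ Q ℤ.- + tri P)
    z = + 2 ℤ.* + X ℤ.- b
    q′ = Q ℕ.+ A ℕ.* X
    t′ = tri (P ℕ.+ X)

  D-[2x-b]²≡8[q′-t′] : D ℤ.- z ℤ.* z ≡ + 8 ℤ.* (+ q′ ℤ.- + t′)
  D-[2x-b]²≡8[q′-t′] = begin
    D ℤ.- z ℤ.* z
      ≡⟨ discriminant-gap (+ P) (+ Q) (+ A) (+ X) (+ tri P) (+ t′) (+tri*2++p≡+p*+p P) +t′*2++p′≡+p′*+p′ ⟩
    + 8 ℤ.* (+ Q ℤ.+ + A ℤ.* + X ℤ.- + t′)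
      ≡⟨ cong (λ s → + 8 ℤ.* (s ℤ.- + t′)) +q′≡+Q++A*+X ⟨
    + 8 ℤ.* (+ q′ ℤ.- + t′) ∎
    where
    +t′*2++p′≡+p′*+p′ : + t′ ℤ.* + 2 ℤ.+ (+ P ℤ.+ + X) ≡ (+ P ℤ.+ + X) ℤ.* (+ P ℤ.+ + X)
    +t′*2++p′≡+p′*+p′ = subst (λ s → + t′ ℤ.* + 2 ℤ.+ s ≡ s ℤ.* s) (ℤ.pos-+ P X) (+tri*2++p≡+p*+p (P ℕ.+ X))
    +q′≡+Q++A*+X : + q′ ≡ + Q ℤ.+ + A ℤ.* + X
    +q′≡+Q++A*+X = trans (ℤ.pos-+ Q (A ℕ.* X)) (cong (ℤ._+_ (+ Q)) (ℤ.pos-* A X))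

  [2x-b]²≤D⇔t′≤q′ : z ℤ.* z ℤ.≤ D ⇔ t′ ≤ q′
  [2x-b]²≤D⇔t′≤q′ = mk⇔
    (λ z²≤D → ℤ.drop‿+≤+ (ℤ.0≤i-j⇒j≤i (ℤ.*-cancelˡ-≤-pos 0ℤ (+ q′ ℤ.- + t′) (+ 8)
                 (subst (0ℤ ℤ.≤_) D-[2x-b]²≡8[q′-t′] (ℤ.i≤j⇒0≤j-i z²≤D)))))
    (λ t′≤q′ → ℤ.0≤i-j⇒j≤i (subst (0ℤ ℤ.≤_) (sym D-[2x-b]²≡8[q′-t′])
                 (ℤ.*-monoˡ-≤-nonNeg (+ 8) (ℤ.i≤j⇒0≤j-i (+≤+ t′≤q′)))))

  [2x-b]²≡D⇔q′≡t′ : z ℤ.* z ≡ D ⇔ q′ ≡ t′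
  [2x-b]²≡D⇔q′≡t′ = mk⇔
    (λ z²≡D → ℤ.+-injective (ℤ.i-j≡0⇒i≡j (+ q′) (+ t′) (ℤ.*-cancelˡ-≡ (+ 8) _ 0ℤ
                 (trans (sym D-[2x-b]²≡8[q′-t′]) (ℤ.i≡j⇒i-j≡0 (sym z²≡D))))))
    (λ q′≡t′ → sym (ℤ.i-j≡0⇒i≡j D (z ℤ.* z)
                 (trans D-[2x-b]²≡8[q′-t′] (cong (+ 8 ℤ.*_) (ℤ.i≡j⇒i-j≡0 (cong +_ q′≡t′))))))

module _ {n : ℕ} (G : ℕ → Set) where

  ∀[1,n]⇔∀Fin-suc : (∀ k → 1 ≤ k → k ≤ n → G k) ⇔ (∀ (j : Fin n) → G (suc (toℕ j)))
  ∀[1,n]⇔∀Fin-suc = mk⇔ (λ H j → H (suc (toℕ j)) (s≤s z≤n) (toℕ<n j)) fromFin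
    where
    fromFin : (∀ (j : Fin n) → G (suc (toℕ j))) → ∀ k → 1 ≤ k → k ≤ n → G k
    fromFin H (suc k) _ k<n = subst (λ i → G (suc i)) (toℕ-fromℕ< k<n) (H (fromℕ< k<n))

  ∀[1,n]⇒∀Fin : G 0 → (∀ k → 1 ≤ k → k ≤ n → G k) → ∀ (j : Fin n) → G (toℕ j)
  ∀[1,n]⇒∀Fin G0 H zero    = G0
  ∀[1,n]⇒∀Fin G0 H (suc j) = H (suc (toℕ j)) (s≤s z≤n) (ℕ.<⇒≤ (toℕ<n (suc j)))

Landau≤ : ∀ {n} → (α x : Fin n → ℕ) → ℕ → Set
Landau≤ α x k = tri (pSum x k) ≤ qSum α x k

Landau≡ : ∀ {n} → (α x : Fin n → ℕ) → ℕ → Set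
Landau≡ α x k = qSum α x k ≡ tri (pSum x k)

module _ {n} (α x : Fin n → ℕ) (j : Fin n) (landau : Landau≤ α x (toℕ j)) (1≤xj : 1 ≤ x j) where
  private
    P = pSum x (toℕ j)
    Q = qSum α x (toℕ j)

    0<x : 0ℤ ℤ.< + x j
    0<x = +<+ 1≤xj

    0≤c : 0ℤ ℤ.≤ cK α x j
    0≤c = ℤ.i≤j⇒0≤j-i (+≤+ landau)

    pSum-suc : pSum x (suc (toℕ j)) ≡ P ℕ.+ x j
    pSum-suc = partialSum-suc x j

    qSum-suc : qSum α x (suc (toℕ j)) ≡ Q ℕ.+ α j ℕ.* x j
    qSum-suc = partialSum-suc (λ i → α i ℕ.* x i) j

  LeHalfBPlusSqrt⇔Landau≤-suc :
    LeHalfBPlusSqrt (+ x j) (bK α x j) (DK α x j) ⇔ Landau≤ α x (suc (toℕ j))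
  LeHalfBPlusSqrt⇔Landau≤-suc =
    subst₂ (λ p q → LeHalfBPlusSqrt (+ x j) (bK α x j) (DK α x j) ⇔ (tri p ≤ q))
      (sym pSum-suc) (sym qSum-suc)
      (⇔-trans (LeHalfBPlusSqrt⇔[2x-b]²≤D 0<x 0≤c) ([2x-b]²≤D⇔t′≤q′ P Q (α j) (x j)))

  EqHalfBPlusSqrt⇔Landau≡-suc :
    EqHalfBPlusSqrt (+ x j) (bK α x j) (DK α x j) ⇔ Landau≡ α x (suc (toℕ j))
  EqHalfBPlusSqrt⇔Landau≡-suc =
    subst₂ (λ p q → EqHalfBPlusSqrt (+ x j) (bK α x j) (DK α x j) ⇔ (q ≡ tri p))
      (sym pSum-suc) (sym qSum-suc)
      (⇔-trans (EqHalfBPlusSqrt⇔[2x-b]²≡D 0<x 0≤c) ([2x-b]²≡D⇔q′≡t′ P Q (α j) (x j)))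

StepCondition : ∀ {n} → (α x : Fin n → ℕ) → Fin n → Set
StepCondition {n} α x j =
  Landau≤ α x (toℕ j)
  × 1 ≤ x j
  × LeHalfBPlusSqrt (+ x j) (bK α x j) (DK α x j)
  × (suc (toℕ j) ≡ n → EqHalfBPlusSqrt (+ x j) (bK α x j) (DK α x j))

theorem2p3 : (n : ℕ) → 2 ≤ n → (α x : Fin n → ℕ)
    → (∀ i j → toℕ i < toℕ j → α i < α j)
    → (∀ i → 1 ≤ x i)
    → (((∀ k → 1 ≤ k → k ≤ n → tri (pSum x k) ≤ qSum α x k)
          × qSum α x n ≡ tri (pSum x n))
       ⇔ (∀ (j : Fin n) →
            tri (pSum x (toℕ j)) ≤ qSum α x (toℕ j)
            × 1 ≤ x j
            × LeHalfBPlusSqrt (+ x j) (bK α x j) (DK α x j)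
            × (suc (toℕ j) ≡ n → EqHalfBPlusSqrt (+ x j) (bK α x j) (DK α x j))))
theorem2p3 (suc m) _ α x _ 1≤x = mk⇔ necessary sufficient
  where
  necessary : (∀ k → 1 ≤ k → k ≤ suc m → Landau≤ α x k) × Landau≡ α x (suc m)
            → ∀ j → StepCondition α x j
  necessary (landau , tight) j =
    landau-j , 1≤x j ,
    from (LeHalfBPlusSqrt⇔Landau≤-suc α x j landau-j (1≤x j)) (to (∀[1,n]⇔∀Fin-suc _) landau j) ,
    λ last → from (EqHalfBPlusSqrt⇔Landau≡-suc α x j landau-j (1≤x j)) (subst (Landau≡ α x) (sym last) tight)
    where
    landau-j : Landau≤ α x (toℕ j)
    landau-j = ∀[1,n]⇒∀Fin (Landau≤ α x) z≤n landau j

  sufficient : (∀ j → StepCondition α x j)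
             → (∀ k → 1 ≤ k → k ≤ suc m → Landau≤ α x k) × Landau≡ α x (suc m)
  sufficient cond = from (∀[1,n]⇔∀Fin-suc _) landau-suc , tight
    where
    landau-suc : ∀ j → Landau≤ α x (suc (toℕ j))
    landau-suc j with cond j
    ... | landau-j , _ , le , _ = to (LeHalfBPlusSqrt⇔Landau≤-suc α x j landau-j (1≤x j)) le
    tight : Landau≡ α x (suc m)
    tight with cond (fromℕ m)
    ... | landau-m , _ , _ , eq =
      subst (λ i → Landau≡ α x (suc i)) (toℕ-fromℕ m)
        (to (EqHalfBPlusSqrt⇔Landau≡-suc α x (fromℕ m) landau-m (1≤x (fromℕ m)))
            (eq (cong suc (toℕ-fromℕ m))))
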